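{- For the cycle $C_n$ ($n \ge 3$), $\textrm{RED:LD}(C_n) = \lceil 2n/3 \rceil$ if $n \ge 5$, and $\textrm{RED:LD}(C_n) = n$ if $n \le 4$.
   Context: $N(v)$ denotes the open neighborhood of $v$. A set $S \subseteq V(G)$ is a locating-dominating (LD) set if for all $u,v \in V(G)-S$: $N(v)\cap S \neq \varnothing$, and if $u \ne v$ then $N(v) \cap S \neq N(u) \cap S$. A RED:LD set is an LD set $S$ such that $S-\{v\}$ is an LD set for every $v \in S$. $\textrm{RED:LD}(G)$ is the minimum cardinality of a RED:LD set of $G$. -}

module Defs where

open import Data.Nat using (ℕ; suc; _+_; _*_; _≤_; _/_; _%_)
open import Data.Fin using (Fin; toℕ)
open import Data.Fin.Subset using (Subset; _∈_; _∉_; _-_; ∣_∣)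
open import Data.Product using (Σ; _×_; ∃-syntax)
open import Data.Sum using (_⊎_)
open import Relation.Nullary using (¬_)
open import Relation.Binary.PropositionalEquality using (_≡_; _≢_)
open import Function.Bundles using (_⇔_)

Graph : ℕ → Set₁
Graph n = Fin n → Fin n → Set

Cycle : (n : ℕ) → Graph (suc n)
Cycle n i j = (toℕ j ≡ (toℕ i + 1) % suc n) ⊎ (toℕ i ≡ (toℕ j + 1) % suc n)

IsLD : ∀ {n} → Graph n → Subset n → Set
IsLD {n} G S =
  ((v : Fin n) → v ∉ S → ∃[ w ] (w ∈ S × G v w)) ×
  ((u v : Fin n) → u ∉ S → v ∉ S → u ≢ v →
     ¬ ((w : Fin n) → w ∈ S → (G u w ⇔ G v w)))

IsREDLD : ∀ {n} → Graph n → Subset n → Set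
IsREDLD {n} G S = IsLD G S × ((v : Fin n) → v ∈ S → IsLD G (S - v))

REDLDNumber : ∀ {n} → Graph n → ℕ → Set
REDLDNumber {n} G k =
  (Σ (Subset n) λ S → IsREDLD G S × ∣ S ∣ ≡ k) ×
  ((S : Subset n) → IsREDLD G S → k ≤ ∣ S ∣)

ceil2n/3 : ℕ → ℕ
ceil2n/3 n = (2 * n + 2) / 3

{-# OPTIONS --safe #-}
-- A vertex u outside a RED:LD set S of a cycle keeps a dominator after either neighbour is
-- deleted from S, so both neighbours lie in S; and u + 1 must stay dominated after its own
-- deletion, by a neighbour in S other than u, so u + 2 ∈ S as well. Thus the vertices outside S
-- are pairwise at distance at least 3, there are at most ⌊n/3⌋ of them, and
-- ∣S∣ ≥ n - ⌊n/3⌋ = ⌈2n/3⌉. For n ≥ 5 this condition is also sufficient, and the complement of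
-- {0, 3, …, 3(⌊n/3⌋ - 1)} attains the bound. For n = 3 (n = 4) a vertex u outside S and u + 1
-- (u + 2) have the same neighbours apart from each other, so deleting u + 1 (u + 2) from S would
-- leave two vertices with the same trace: every RED:LD set is the whole vertex set.
module Submission where

open import Defs
open import Data.Bool using (Bool; true; false)
open import Data.Bool.Properties using (¬-not)
open import Data.Empty using (⊥)
open import Data.Fin using (Fin; toℕ; fromℕ<; zero; suc) renaming (_≟_ to _≟ᶠ_)
open import Data.Fin.Properties using (toℕ-injective; toℕ-fromℕ<; toℕ<n)
open import Data.Fin.Subset using (Subset; _∈_; _∉_; _⊆_; _-_; ⁅_⁆; ∣_∣; ⊤)
open import Data.Fin.Subset.Properties
  using (_∈?_; p─q⊆p; x∈p∧x≢y⇒x∈p-y; ∈⊤; ∣⊤∣≡n; p⊆q⇒∣p∣≤∣q∣)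
open import Data.Nat using (ℕ; NonZero; zero; suc; _+_; _*_; _∸_; _≤_; _<_; z≤n; s≤s; _/_; _%_; _<?_; _≤?_)
open import Data.Nat.DivMod
open import Data.Nat.Divisibility using (divides)
open import Data.Nat.Properties
open import Data.Nat.Solver using (module +-*-Solver)
open import Data.Product using (_×_; _,_; proj₁; proj₂; ∃-syntax; ∃₂)
open import Data.Sum using (_⊎_; inj₁; inj₂; swap)
open import Data.Vec using (Vec; []; _∷_; there; lookup; tabulate)
open import Data.Vec.Properties using ([]=⇒lookup; lookup⇒[]=; lookup∘tabulate)
open import Function using (_∘_)
open import Function.Bundles using (_⇔_; mk⇔; Equivalence)
open import Function.Properties.Equivalence using () renaming (sym to ⇔-sym)
open import Relation.Nullary using (¬_; yes; no; contradiction)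
open import Relation.Nullary.Decidable using (True; toWitness; decidable-stable)
open import Relation.Binary.PropositionalEquality
open +-*-Solver

x∉p-x : ∀ {n} (x : Fin n) p → x ∉ p - x
x∉p-x zero    (_ ∷ p) ()
x∉p-x (suc x) (_ ∷ p) (there x∈p-x) = x∉p-x x p x∈p-x

module _ {n : ℕ} where

  x∈p-y⇒x∈p : ∀ {p : Subset n} {x y} → x ∈ p - y → x ∈ p
  x∈p-y⇒x∈p {p} {y = y} = p─q⊆p p ⁅ y ⁆

  x∈p-y⇒x≢y : ∀ {p : Subset n} {x y} → x ∈ p - y → x ≢ y
  x∈p-y⇒x≢y {p} x∈p-y refl = x∉p-x _ p x∈p-y

  x∉p-y⇒x∉p⊎x≡y : ∀ {p : Subset n} {x y} → x ∉ p - y → x ∉ p ⊎ x ≡ y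
  x∉p-y⇒x∉p⊎x≡y {p} {x} {y} x∉p-y with x ∈? p | x ≟ᶠ y
  ... | no x∉p | _        = inj₁ x∉p
  ... | yes _  | yes x≡y  = inj₂ x≡y
  ... | yes x∈p | no x≢y  = contradiction (x∈p∧x≢y⇒x∈p-y x∈p x≢y) x∉p-y

  lookup≡false⇒∉ : ∀ {p : Subset n} {x} → lookup p x ≡ false → x ∉ p
  lookup≡false⇒∉ p[x]≡false x∈p with trans (sym ([]=⇒lookup x∈p)) p[x]≡false
  ... | ()

  ∉⇒lookup≡false : ∀ {p : Subset n} {x} → x ∉ p → lookup p x ≡ false
  ∉⇒lookup≡false {p} {x} x∉p = ¬-not (x∉p ∘ lookup⇒[]= x p)

module _ {n : ℕ} {G : Graph n} {S : Subset n} where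

  IsLD-mono : ∀ {T} → S ⊆ T → IsLD G S → IsLD G T
  IsLD-mono S⊆T (dominating , locating) =
    (λ v v∉T → let w , w∈S , Gvw = dominating v (v∉T ∘ S⊆T) in w , S⊆T w∈S , Gvw) ,
    (λ u v u∉T v∉T u≢v sameTrace →
       locating u v (u∉T ∘ S⊆T) (v∉T ∘ S⊆T) u≢v (λ w → sameTrace w ∘ S⊆T))

  redld-nonmember-has-two-neighbours : IsREDLD G S → ∀ {u} → u ∉ S →
    ∃₂ λ w w′ → w ∈ S × w′ ∈ S × w′ ≢ w × G u w × G u w′
  redld-nonmember-has-two-neighbours ((dominating , _) , redundant) u∉S =
    let w , w∈S , Guw = dominating _ u∉S
        w′ , w′∈S-w , Guw′ = proj₁ (redundant w w∈S) _ (u∉S ∘ x∈p-y⇒x∈p)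
    in w , w′ , w∈S , x∈p-y⇒x∈p w′∈S-w , x∈p-y⇒x≢y w′∈S-w , Guw , Guw′

  redld-member-has-neighbour : IsREDLD G S → ∀ {v} → v ∈ S → ∃[ w ] (w ∈ S × G v w)
  redld-member-has-neighbour (_ , redundant) {v} v∈S =
    let w , w∈S-v , Gvw = proj₁ (redundant v v∈S) v (x∉p-x v S)
    in w , x∈p-y⇒x∈p w∈S-v , Gvw

  redld-twins-outside : IsREDLD G S → ∀ {u v} → u ≢ v →
    (∀ w → w ≢ u → w ≢ v → (G u w ⇔ G v w)) → u ∉ S → v ∉ S
  redld-twins-outside (_ , redundant) {u} {v} u≢v twins u∉S v∈S =
    proj₂ (redundant v v∈S) u v (u∉S ∘ x∈p-y⇒x∈p) (x∉p-x v S) u≢v λ w w∈S-v →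
      twins w (λ { refl → u∉S (x∈p-y⇒x∈p w∈S-v) }) (x∈p-y⇒x≢y w∈S-v)

isFalse : Bool → ℕ
isFalse true  = 0
isFalse false = 1

falses : (ℕ → Bool) → ℕ → ℕ
falses h zero    = 0
falses h (suc k) = isFalse (h 0) + falses (h ∘ suc) k

Sparse : (ℕ → Bool) → Set
Sparse h = ∀ i → h i ≡ false → h (suc i) ≡ true × h (suc (suc i)) ≡ true

Periodic : ℕ → (ℕ → Bool) → Set
Periodic N h = ∀ i → h (i + N) ≡ h i

falses-suc : ∀ h k → falses h (suc k) ≡ falses h k + isFalse (h k)
falses-suc h zero    = +-comm (isFalse (h 0)) 0
falses-suc h (suc k) = begin
  isFalse (h 0) + falses (h ∘ suc) (suc k)                 ≡⟨ cong (isFalse (h 0) +_) (falses-suc (h ∘ suc) k) ⟩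
  isFalse (h 0) + (falses (h ∘ suc) k + isFalse (h (suc k))) ≡⟨ +-assoc (isFalse (h 0)) _ _ ⟨
  falses h (suc k) + isFalse (h (suc k))                     ∎
  where open ≡-Reasoning

falses-shift : ∀ {N h} → Periodic N h → falses (h ∘ suc) N ≡ falses h N
falses-shift {N} {h} periodic = +-cancelˡ-≡ (isFalse (h 0)) _ _ (begin
  falses h (suc N)              ≡⟨ falses-suc h N ⟩
  falses h N + isFalse (h N)    ≡⟨ cong (λ b → falses h N + isFalse b) (periodic 0) ⟩
  falses h N + isFalse (h 0)    ≡⟨ +-comm (falses h N) _ ⟩
  isFalse (h 0) + falses h N    ∎)
  where open ≡-Reasoning

sparse-window≤1 : ∀ {h} → Sparse h → isFalse (h 0) + isFalse (h 1) + isFalse (h 2) ≤ 1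
sparse-window≤1 {h} sparse with h 0 in h0
... | false rewrite proj₁ (sparse 0 h0) | proj₂ (sparse 0 h0) = ≤-refl
... | true with h 1 in h1
...   | false rewrite proj₁ (sparse 1 h1) = ≤-refl
...   | true with h 2
...     | false = ≤-refl
...     | true  = z≤n

-- The left side sums, over i < k, the number of falses among h i, h (i + 1), h (i + 2).
sparse-falses : ∀ {h} → Sparse h → ∀ k →
  falses h k + falses (h ∘ suc) k + falses (λ i → h (suc (suc i))) k ≤ k
sparse-falses sparse zero = z≤n
sparse-falses {h} sparse (suc k) = subst (_≤ suc k)
  (interleave (isFalse (h 0)) (isFalse (h 1)) (isFalse (h 2))
              (falses (h ∘ suc) k) (falses (λ i → h (suc (suc i))) k) (falses (λ i → h (suc (suc (suc i)))) k))
  (+-mono-≤ (sparse-window≤1 sparse) (sparse-falses (sparse ∘ suc) k))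
  where
  interleave : ∀ a b c x y z → (a + b + c) + (x + y + z) ≡ (a + x) + (b + y) + (c + z)
  interleave = solve 6 (λ a b c x y z →
    (a :+ b :+ c) :+ (x :+ y :+ z) := (a :+ x) :+ (b :+ y) :+ (c :+ z)) refl

periodic-sparse-falses : ∀ {N h} → Periodic N h → Sparse h → falses h N * 3 ≤ N
periodic-sparse-falses {N} {h} periodic sparse = subst (_≤ N) three-copies (sparse-falses sparse N)
  where
  three-copies : falses h N + falses (h ∘ suc) N + falses (λ i → h (suc (suc i))) N ≡ falses h N * 3
  three-copies
    rewrite falses-shift (λ i → periodic (suc i)) | falses-shift periodic = solve 1 (λ c → c :+ c :+ c := c :* con 3) refl (falses h N)

∣v∣+falses≡length : ∀ {k} (v : Vec Bool k) h → (∀ j → h (toℕ j) ≡ lookup v j) → ∣ v ∣ + falses h k ≡ k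
∣v∣+falses≡length []      h agree = refl
∣v∣+falses≡length (b ∷ v) h agree with h 0 | agree zero
... | true  | refl = cong suc (∣v∣+falses≡length v (h ∘ suc) (agree ∘ suc))
... | false | refl = trans (+-suc ∣ v ∣ _) (cong suc (∣v∣+falses≡length v (h ∘ suc) (agree ∘ suc)))

everyThird : ℕ → ℕ → Bool
everyThird zero    _                   = true
everyThird (suc q) 0                   = false
everyThird (suc q) 1                   = true
everyThird (suc q) 2                   = true
everyThird (suc q) (suc (suc (suc t))) = everyThird q t

falses-everyThird : ∀ q r → falses (everyThird q) (q * 3 + r) ≡ q
falses-everyThird zero    zero    = refl
falses-everyThird zero    (suc r) = falses-everyThird zero r
falses-everyThird (suc q) r       = cong suc (falses-everyThird q r)

everyThird-sparse : ∀ q t → everyThird q t ≡ false →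
  everyThird q (1 + t) ≡ true × everyThird q (2 + t) ≡ true × 2 + t < q * 3
everyThird-sparse (suc q) zero                refl = refl , refl , s≤s (s≤s (s≤s z≤n))
everyThird-sparse (suc q) (suc (suc (suc t))) eq   =
  let next , next² , bound = everyThird-sparse q t eq in next , next² , s≤s (s≤s (s≤s bound))

[m+k*3]/3≡m/3+k : ∀ m k → (m + k * 3) / 3 ≡ m / 3 + k
[m+k*3]/3≡m/3+k m k = trans (+-distrib-/-∣ʳ m (divides k refl)) (cong (m / 3 +_) (m*n/n≡m k 3))

ceil2n/3+n/3≡n : ∀ n → ceil2n/3 n + n / 3 ≡ n
ceil2n/3+n/3≡n n = begin
  ceil2n/3 n + n / 3                                      ≡⟨ cong (λ x → ceil2n/3 x + x / 3) n≡r+q*3 ⟩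
  (2 * (r + q * 3) + 2) / 3 + (r + q * 3) / 3             ≡⟨ cong (λ x → x / 3 + (r + q * 3) / 3) (regroup r q) ⟩
  ((2 * r + 2) + 2 * q * 3) / 3 + (r + q * 3) / 3         ≡⟨ cong₂ _+_ ([m+k*3]/3≡m/3+k (2 * r + 2) (2 * q)) ([m+k*3]/3≡m/3+k r q) ⟩
  (2 * r + 2) / 3 + 2 * q + (r / 3 + q)                   ≡⟨ collect ((2 * r + 2) / 3) (r / 3) q ⟩
  ((2 * r + 2) / 3 + r / 3) + q * 3                       ≡⟨ cong (_+ q * 3) (small-case r (m%n<n n 3)) ⟩
  r + q * 3                                               ≡⟨ n≡r+q*3 ⟨
  n                                                       ∎
  where
  open ≡-Reasoning
  r = n % 3
  q = n / 3
  n≡r+q*3 : n ≡ r + q * 3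
  n≡r+q*3 = m≡m%n+[m/n]*n n 3
  regroup : ∀ r q → 2 * (r + q * 3) + 2 ≡ (2 * r + 2) + 2 * q * 3
  regroup = solve 2 (λ r q → con 2 :* (r :+ q :* con 3) :+ con 2 := (con 2 :* r :+ con 2) :+ con 2 :* q :* con 3) refl
  collect : ∀ a b q → a + 2 * q + (b + q) ≡ (a + b) + q * 3
  collect = solve 3 (λ a b q → a :+ con 2 :* q :+ (b :+ q) := (a :+ b) :+ q :* con 3) refl
  small-case : ∀ r → r < 3 → (2 * r + 2) / 3 + r / 3 ≡ r
  small-case 0 _ = refl
  small-case 1 _ = refl
  small-case 2 _ = refl
  small-case (suc (suc (suc _))) (s≤s (s≤s (s≤s ())))

ceil2n/3≤ : ∀ {n a c} → a + c ≡ n → c * 3 ≤ n → ceil2n/3 n ≤ a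
ceil2n/3≤ {n} {a} {c} a+c≡n c*3≤n = +-cancelʳ-≤ (n / 3) (ceil2n/3 n) a (begin
  ceil2n/3 n + n / 3   ≡⟨ ceil2n/3+n/3≡n n ⟩
  n                    ≡⟨ a+c≡n ⟨
  a + c                ≤⟨ +-monoʳ-≤ a c≤n/3 ⟩
  a + n / 3            ∎)
  where
  open ≤-Reasoning
  c≤n/3 : c ≤ n / 3
  c≤n/3 = subst (_≤ n / 3) (m*n/n≡m c 3) (/-monoˡ-≤ 3 c*3≤n)

[k+t]%n≢t : ∀ {n k t} .{{_ : NonZero n}} → 0 < k → k < n → t < n → (k + t) % n ≢ t
[k+t]%n≢t {n} {k} {t} 0<k k<n t<n [k+t]%n≡t with k + t <? n
... | yes k+t<n = <⇒≢ (+-monoˡ-< t 0<k) (sym (trans (sym (m<n⇒m%n≡m k+t<n)) [k+t]%n≡t))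
... | no k+t≮n = <⇒≢ k<n (+-cancelʳ-≡ t k n (begin
  k + t            ≡⟨ m∸n+n≡m n≤k+t ⟨
  k + t ∸ n + n    ≡⟨ cong (_+ n) k+t∸n≡t ⟩
  t + n            ≡⟨ +-comm t n ⟩
  n + t            ∎))
  where
  open ≡-Reasoning
  n≤k+t : n ≤ k + t
  n≤k+t = ≮⇒≥ k+t≮n
  k+t∸n≡t : k + t ∸ n ≡ t
  k+t∸n≡t = begin
    k + t ∸ n           ≡⟨ m<n⇒m%n≡m (m<n+o⇒m∸n<o (k + t) n (+-mono-< k<n t<n)) ⟨
    (k + t ∸ n) % n     ≡⟨ m≤n⇒[n∸m]%m≡n%m n≤k+t ⟩
    (k + t) % n         ≡⟨ [k+t]%n≡t ⟩
    t                   ∎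

module CycleProperties (m : ℕ) where

  N : ℕ
  N = suc m

  vertex : ℕ → Fin N
  vertex i = fromℕ< (m%n<n i N)

  toℕ-vertex : ∀ i → toℕ (vertex i) ≡ i % N
  toℕ-vertex i = toℕ-fromℕ< _

  vertex-toℕ : ∀ a → vertex (toℕ a) ≡ a
  vertex-toℕ a = toℕ-injective (trans (toℕ-vertex (toℕ a)) (m<n⇒m%n≡m (toℕ<n a)))

  vertex-+N : ∀ i → vertex (i + N) ≡ vertex i
  vertex-+N i = toℕ-injective (trans (toℕ-vertex (i + N)) (trans ([m+n]%n≡m%n i N) (sym (toℕ-vertex i))))

  next : Fin N → Fin N
  next a = vertex (toℕ a + 1)

  next^ : ℕ → Fin N → Fin N
  next^ zero    a = a
  next^ (suc k) a = next (next^ k a)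

  prev : Fin N → Fin N
  prev = next^ m

  vertex-suc : ∀ i → vertex (suc i) ≡ next (vertex i)
  vertex-suc i = toℕ-injective (begin
    toℕ (vertex (suc i))             ≡⟨ toℕ-vertex (suc i) ⟩
    suc i % N                        ≡⟨ cong (_% N) (+-comm 1 i) ⟩
    (i + 1) % N                      ≡⟨ %-distribˡ-+ i 1 N ⟩
    (i % N + 1 % N) % N              ≡⟨ cong (λ j → (j + 1 % N) % N) (m%n%n≡m%n i N) ⟨
    (i % N % N + 1 % N) % N          ≡⟨ %-distribˡ-+ (i % N) 1 N ⟨
    (i % N + 1) % N                  ≡⟨ cong (λ j → (j + 1) % N) (toℕ-vertex i) ⟨
    (toℕ (vertex i) + 1) % N         ≡⟨ toℕ-vertex (toℕ (vertex i) + 1) ⟨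
    toℕ (next (vertex i))            ∎)
    where open ≡-Reasoning

  next^-vertex : ∀ k i → next^ k (vertex i) ≡ vertex (k + i)
  next^-vertex zero    i = refl
  next^-vertex (suc k) i = trans (cong next (next^-vertex k i)) (sym (vertex-suc (k + i)))

  toℕ-next^ : ∀ k a → toℕ (next^ k a) ≡ (k + toℕ a) % N
  toℕ-next^ k a = begin
    toℕ (next^ k a)                  ≡⟨ cong (toℕ ∘ next^ k) (vertex-toℕ a) ⟨
    toℕ (next^ k (vertex (toℕ a)))   ≡⟨ cong toℕ (next^-vertex k (toℕ a)) ⟩
    toℕ (vertex (k + toℕ a))         ≡⟨ toℕ-vertex (k + toℕ a) ⟩
    (k + toℕ a) % N                  ∎
    where open ≡-Reasoning

  next^-N : ∀ a → next^ N a ≡ a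
  next^-N a = begin
    next^ N a                   ≡⟨ cong (next^ N) (vertex-toℕ a) ⟨
    next^ N (vertex (toℕ a))    ≡⟨ next^-vertex N (toℕ a) ⟩
    vertex (N + toℕ a)          ≡⟨ cong vertex (+-comm N (toℕ a)) ⟩
    vertex (toℕ a + N)          ≡⟨ vertex-+N (toℕ a) ⟩
    vertex (toℕ a)              ≡⟨ vertex-toℕ a ⟩
    a                           ∎
    where open ≡-Reasoning

  next^-+ : ∀ j k a → next^ j (next^ k a) ≡ next^ (j + k) a
  next^-+ zero    k a = refl
  next^-+ (suc j) k a = cong next (next^-+ j k a)

  next-prev : ∀ a → next (prev a) ≡ a
  next-prev = next^-N

  prev-next : ∀ a → prev (next a) ≡ a
  prev-next a = trans (next^-+ m 1 a) (trans (cong (λ k → next^ k a) (+-comm m 1)) (next^-N a))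

  next-injective : ∀ {a b} → next a ≡ next b → a ≡ b
  next-injective {a} {b} next-a≡next-b =
    trans (sym (prev-next a)) (trans (cong prev next-a≡next-b) (prev-next b))

  next^-≢ : ∀ {k} a → 0 < k → k < N → next^ k a ≢ a
  next^-≢ {k} a 0<k k<N next^-k-a≡a =
    [k+t]%n≢t 0<k k<N (toℕ<n a) (trans (sym (toℕ-next^ k a)) (cong toℕ next^-k-a≡a))

  next^-distinct : ∀ {i j} a → i < j → j < N → next^ i a ≢ next^ j a
  next^-distinct {i} {j} a i<j j<N next^-i≡next^-j = next^-≢ (next^ i a) (m<n⇒0<n∸m i<j) (≤-<-trans (m∸n≤m j i) j<N) (begin
    next^ (j ∸ i) (next^ i a)   ≡⟨ next^-+ (j ∸ i) i a ⟩
    next^ (j ∸ i + i) a         ≡⟨ cong (λ k → next^ k a) (m∸n+n≡m (<⇒≤ i<j)) ⟩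
    next^ j a                   ≡⟨ next^-i≡next^-j ⟨
    next^ i a                   ∎)
    where open ≡-Reasoning

  Cycle⇒next : ∀ {a b} → Cycle m a b → b ≡ next a ⊎ a ≡ next b
  Cycle⇒next {a} (inj₁ toℕb≡) = inj₁ (toℕ-injective (trans toℕb≡ (sym (toℕ-vertex (toℕ a + 1)))))
  Cycle⇒next {b = b} (inj₂ toℕa≡) = inj₂ (toℕ-injective (trans toℕa≡ (sym (toℕ-vertex (toℕ b + 1)))))

  Cycle-next : ∀ a → Cycle m a (next a)
  Cycle-next a = inj₁ (toℕ-vertex (toℕ a + 1))

  Cycle-sym : ∀ {a b} → Cycle m a b → Cycle m b a
  Cycle-sym = swap

  Cycle-prev : ∀ a → Cycle m a (prev a)
  Cycle-prev a = Cycle-sym (subst (Cycle m (prev a)) (next-prev a) (Cycle-next (prev a)))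

  SparseComplement : Subset N → Set
  SparseComplement S = ∀ u → u ∉ S → next u ∈ S × next (next u) ∈ S

  redld⇒sparse : ∀ {S} → IsREDLD (Cycle m) S → SparseComplement S
  redld⇒sparse {S} redld u u∉S = next∈S , next²∈S
    where
    next∈S : next u ∈ S
    next∈S with redld-nonmember-has-two-neighbours redld u∉S
    ... | w , w′ , w∈S , w′∈S , w′≢w , Guw , Guw′ with Cycle⇒next Guw | Cycle⇒next Guw′
    ...   | inj₁ refl | _         = w∈S
    ...   | inj₂ _    | inj₁ refl = w′∈S
    ...   | inj₂ u≡next-w | inj₂ u≡next-w′ = contradiction (next-injective (trans (sym u≡next-w′) u≡next-w)) w′≢w
    next²∈S : next (next u) ∈ S
    next²∈S with redld-member-has-neighbour redld next∈S
    ... | w , w∈S , Gw with Cycle⇒next Gw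
    ...   | inj₁ refl = w∈S
    ...   | inj₂ next-u≡next-w = contradiction (subst (_∈ S) (sym (next-injective next-u≡next-w)) w∈S) u∉S

  sparse⇒ceil2n/3≤∣S∣ : ∀ {S} → SparseComplement S → ceil2n/3 N ≤ ∣ S ∣
  sparse⇒ceil2n/3≤∣S∣ {S} sparse =
    ceil2n/3≤ (∣v∣+falses≡length S h (cong (lookup S) ∘ vertex-toℕ))
              (periodic-sparse-falses (cong (lookup S) ∘ vertex-+N) h-sparse)
    where
    h : ℕ → Bool
    h = lookup S ∘ vertex
    h≡true : ∀ {i x} → vertex i ≡ x → x ∈ S → h i ≡ true
    h≡true refl x∈S = []=⇒lookup x∈S
    h-sparse : Sparse h
    h-sparse i hi≡false =
      let next∈S , next²∈S = sparse (vertex i) (lookup≡false⇒∉ hi≡false)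
      in h≡true {suc i} (vertex-suc i) next∈S ,
         h≡true {suc (suc i)} (trans (vertex-suc (suc i)) (cong next (vertex-suc i))) next²∈S

  module Sufficiency (4<N : 4 < N) {S : Subset N} (sparse : SparseComplement S) where

    distinct : ∀ i j {_ : True (i <? j)} {_ : True (j ≤? 4)} a → next^ i a ≢ next^ j a
    distinct i j {i<j} {j≤4} a = next^-distinct a (toWitness i<j) (≤-<-trans (toWitness j≤4) 4<N)

    prev∈S : ∀ {u} → u ∉ S → prev u ∈ S
    prev∈S {u} u∉S = decidable-stable (prev u ∈? S) λ prev∉S →
      u∉S (subst (_∈ S) (next-prev u) (proj₁ (sparse (prev u) prev∉S)))

    member-neighbour : ∀ {x} → x ∈ S → next x ∈ S ⊎ prev x ∈ S
    member-neighbour {x} x∈S with prev x ∈? S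
    ... | yes prev∈S = inj₂ prev∈S
    ... | no prev∉S  = inj₁ (subst (λ y → next y ∈ S) (next-prev x) (proj₂ (sparse (prev x) prev∉S)))

    module _ {x : Fin N} (x∈S : x ∈ S) where

      SameTrace : Fin N → Fin N → Set
      SameTrace u v = ∀ w → w ∈ S - x → (Cycle m u w ⇔ Cycle m v w)

      dominating : ∀ v → v ∉ S - x → ∃[ w ] (w ∈ S - x × Cycle m v w)
      dominating v v∉S-x with x∉p-y⇒x∉p⊎x≡y v∉S-x
      ... | inj₂ refl with member-neighbour x∈S
      ...   | inj₁ next∈S = next x , x∈p∧x≢y⇒x∈p-y next∈S (distinct 0 1 x ∘ sym) , Cycle-next x
      ...   | inj₂ prev∈S = prev x , x∈p∧x≢y⇒x∈p-y prev∈S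
                (λ prev≡x → distinct 0 1 x (trans (sym (next-prev x)) (cong next prev≡x))) , Cycle-prev x
      dominating v v∉S-x | inj₁ v∉S with next v ≟ᶠ x
      ...   | no next≢x  = next v , x∈p∧x≢y⇒x∈p-y (proj₁ (sparse v v∉S)) next≢x , Cycle-next v
      ...   | yes next≡x = prev v , x∈p∧x≢y⇒x∈p-y (prev∈S v∉S)
                (λ prev≡x → distinct 0 2 (prev v) (trans prev≡x (trans (sym next≡x) (cong next (sym (next-prev v)))))) ,
                Cycle-prev v

      consecutive-outside : ∀ c → c ∉ S - x → next c ∉ S - x → c ≡ x ⊎ next c ≡ x
      consecutive-outside c c∉S-x next∉S-x with x∉p-y⇒x∉p⊎x≡y c∉S-x | x∉p-y⇒x∉p⊎x≡y next∉S-x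
      ... | inj₂ c≡x | _             = inj₁ c≡x
      ... | inj₁ _   | inj₂ next≡x   = inj₂ next≡x
      ... | inj₁ c∉S | inj₁ next∉S   = contradiction (proj₁ (sparse c c∉S)) next∉S

      -- c and next⁴ c would distinguish the pair, so c, next c, next³ c, next⁴ c all lie outside S - x;
      -- then each of the consecutive pairs (c, next c) and (next³ c, next⁴ c) must contain x.
      next-next³-distinguished : ∀ c → next c ∉ S - x → next^ 3 c ∉ S - x → ¬ SameTrace (next c) (next^ 3 c)
      next-next³-distinguished c next∉S-x next³∉S-x same =
        x-twice (consecutive-outside c c∉S-x next∉S-x) (consecutive-outside (next^ 3 c) next³∉S-x next⁴∉S-x)
        where
        c∉S-x : c ∉ S - x
        c∉S-x c∈S-x with Cycle⇒next (Equivalence.to (same c c∈S-x) (Cycle-sym (Cycle-next c)))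
        ... | inj₁ c≡next⁴ = distinct 0 4 c c≡next⁴
        ... | inj₂ next³≡next = distinct 1 3 c (sym next³≡next)
        next⁴∉S-x : next^ 4 c ∉ S - x
        next⁴∉S-x next⁴∈S-x with Cycle⇒next (Equivalence.from (same _ next⁴∈S-x) (Cycle-next (next^ 3 c)))
        ... | inj₁ next⁴≡next² = distinct 2 4 c (sym next⁴≡next²)
        ... | inj₂ next≡next⁵ = distinct 0 4 c (next-injective next≡next⁵)
        x-twice : c ≡ x ⊎ next c ≡ x → next^ 3 c ≡ x ⊎ next^ 4 c ≡ x → ⊥
        x-twice (inj₁ c≡x)    (inj₁ next³≡x) = distinct 0 3 c (trans c≡x (sym next³≡x))
        x-twice (inj₁ c≡x)    (inj₂ next⁴≡x) = distinct 0 4 c (trans c≡x (sym next⁴≡x))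
        x-twice (inj₂ next≡x) (inj₁ next³≡x) = distinct 1 3 c (trans next≡x (sym next³≡x))
        x-twice (inj₂ next≡x) (inj₂ next⁴≡x) = distinct 1 4 c (trans next≡x (sym next⁴≡x))

      two-apart-distinguished : ∀ a → a ∉ S - x → next (next a) ∉ S - x → ¬ SameTrace a (next (next a))
      two-apart-distinguished a =
        subst (λ a → a ∉ S - x → next (next a) ∉ S - x → ¬ SameTrace a (next (next a)))
              (next-prev a) (next-next³-distinguished (prev a))

      locating : ∀ a b → a ∉ S - x → b ∉ S - x → a ≢ b → ¬ SameTrace a b
      locating a b a∉S-x b∉S-x a≢b same with dominating a a∉S-x
      ... | y , y∈S-x , Gay with Cycle⇒next Gay | Cycle⇒next (Equivalence.to (same y y∈S-x) Gay)
      ...   | inj₁ y≡next-a | inj₁ y≡next-b = a≢b (next-injective (trans (sym y≡next-a) y≡next-b))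
      ...   | inj₂ a≡next-y | inj₂ b≡next-y = a≢b (trans a≡next-y (sym b≡next-y))
      ...   | inj₁ refl     | inj₂ refl     = two-apart-distinguished a a∉S-x b∉S-x same
      ...   | inj₂ refl     | inj₁ refl     = two-apart-distinguished b b∉S-x a∉S-x (λ w → ⇔-sym ∘ same w)

      IsLD-minus : IsLD (Cycle m) (S - x)
      IsLD-minus = dominating , locating

    some-member : ∃[ x ] x ∈ S
    some-member with zero ∈? S
    ... | yes 0∈S = zero , 0∈S
    ... | no 0∉S  = next zero , proj₁ (sparse zero 0∉S)

    sparse⇒redld : IsREDLD (Cycle m) S
    sparse⇒redld = IsLD-mono (p─q⊆p S ⁅ x ⁆) (IsLD-minus x∈S) , λ _ → IsLD-minus
      where
      x = proj₁ some-member
      x∈S = proj₂ some-member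

  S₀ : Subset N
  S₀ = tabulate (everyThird (N / 3) ∘ toℕ)

  lookup-S₀ : ∀ a → lookup S₀ a ≡ everyThird (N / 3) (toℕ a)
  lookup-S₀ = lookup∘tabulate (everyThird (N / 3) ∘ toℕ)

  S₀-sparse : SparseComplement S₀
  S₀-sparse u u∉S₀ = member 1 (proj₁ gap) , member 2 (proj₁ (proj₂ gap))
    where
    gap = everyThird-sparse (N / 3) (toℕ u) (trans (sym (lookup-S₀ u)) (∉⇒lookup≡false u∉S₀))
    member : ∀ k {_ : True (k ≤? 2)} → everyThird (N / 3) (k + toℕ u) ≡ true → next^ k u ∈ S₀
    member k {k≤2} everyThird≡true = lookup⇒[]= (next^ k u) S₀ (begin
      lookup S₀ (next^ k u)               ≡⟨ lookup-S₀ (next^ k u) ⟩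
      everyThird (N / 3) (toℕ (next^ k u)) ≡⟨ cong (everyThird (N / 3)) (trans (toℕ-next^ k u) (m<n⇒m%n≡m k+u<N)) ⟩
      everyThird (N / 3) (k + toℕ u)       ≡⟨ everyThird≡true ⟩
      true                                 ∎)
      where
      open ≡-Reasoning
      k+u<N : k + toℕ u < N
      k+u<N = ≤-<-trans (+-monoˡ-≤ (toℕ u) (toWitness k≤2)) (<-≤-trans (proj₂ (proj₂ gap)) (m/n*n≤m N 3))

  ∣S₀∣≡ceil2n/3 : ∣ S₀ ∣ ≡ ceil2n/3 N
  ∣S₀∣≡ceil2n/3 = +-cancelʳ-≡ (N / 3) ∣ S₀ ∣ (ceil2n/3 N) (begin
    ∣ S₀ ∣ + N / 3                           ≡⟨ cong (∣ S₀ ∣ +_) falses-S₀ ⟨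
    ∣ S₀ ∣ + falses (everyThird (N / 3)) N   ≡⟨ ∣v∣+falses≡length S₀ (everyThird (N / 3)) (sym ∘ lookup-S₀) ⟩
    N                                        ≡⟨ ceil2n/3+n/3≡n N ⟨
    ceil2n/3 N + N / 3                       ∎)
    where
    open ≡-Reasoning
    falses-S₀ : falses (everyThird (N / 3)) N ≡ N / 3
    falses-S₀ = trans (cong (falses (everyThird (N / 3))) (trans (m≡m%n+[m/n]*n N 3) (+-comm (N % 3) (N / 3 * 3))))
                      (falses-everyThird (N / 3) (N % 3))

  redld-number-large : 4 < N → REDLDNumber (Cycle m) (ceil2n/3 N)
  redld-number-large 4<N =
    (S₀ , Sufficiency.sparse⇒redld 4<N S₀-sparse , ∣S₀∣≡ceil2n/3) ,
    λ S redld → sparse⇒ceil2n/3≤∣S∣ (redld⇒sparse redld)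

  redld-number-full : 1 < N → (∀ {S} → IsREDLD (Cycle m) S → ⊤ ⊆ S) → REDLDNumber (Cycle m) N
  redld-number-full 1<N redld⇒⊤⊆ =
    (⊤ , ⊤-redld , ∣⊤∣≡n N) ,
    λ S redld → subst (_≤ ∣ S ∣) (∣⊤∣≡n N) (p⊆q⇒∣p∣≤∣q∣ (redld⇒⊤⊆ redld))
    where
    only-x : ∀ {x v} → v ∉ ⊤ - x → v ≡ x
    only-x v∉⊤-x with x∉p-y⇒x∉p⊎x≡y v∉⊤-x
    ... | inj₁ v∉⊤ = contradiction ∈⊤ v∉⊤
    ... | inj₂ v≡x = v≡x
    ⊤-redld : IsREDLD (Cycle m) ⊤
    ⊤-redld = ((λ v v∉⊤ → contradiction ∈⊤ v∉⊤) , (λ u _ u∉⊤ → contradiction ∈⊤ u∉⊤)) ,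
              λ x _ →
                (λ v v∉⊤-x → next v ,
                   x∈p∧x≢y⇒x∈p-y ∈⊤ (λ next≡x → next^-≢ v (s≤s z≤n) 1<N (trans next≡x (sym (only-x v∉⊤-x)))) ,
                   Cycle-next v) ,
                (λ u v u∉⊤-x v∉⊤-x u≢v _ → u≢v (trans (only-x u∉⊤-x) (sym (only-x v∉⊤-x))))

redld-number-C₃ : REDLDNumber (Cycle 2) 3
redld-number-C₃ = redld-number-full (s≤s (s≤s z≤n)) λ {S} redld {u} _ →
  decidable-stable (u ∈? S) λ u∉S →
    redld-twins-outside redld (next^-≢ u (s≤s z≤n) (s≤s (s≤s z≤n)) ∘ sym) (twins u) u∉S (proj₁ (redld⇒sparse redld u u∉S))
  where
  open CycleProperties 2
  -- Here prev = next^ 2 unfolds to next ∘ next.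
  twins : ∀ u w → w ≢ u → w ≢ next u → (Cycle 2 u w ⇔ Cycle 2 (next u) w)
  twins u w w≢u w≢next = mk⇔ to from
    where
    to : Cycle 2 u w → Cycle 2 (next u) w
    to Guw with Cycle⇒next Guw
    ... | inj₁ w≡next = contradiction w≡next w≢next
    ... | inj₂ u≡next-w = subst (Cycle 2 (next u)) (trans (cong prev u≡next-w) (prev-next w)) (Cycle-next (next u))
    from : Cycle 2 (next u) w → Cycle 2 u w
    from Gw with Cycle⇒next Gw
    ... | inj₁ w≡prev = subst (Cycle 2 u) (sym w≡prev) (Cycle-prev u)
    ... | inj₂ next≡next = contradiction (sym (next-injective next≡next)) w≢u

redld-number-C₄ : REDLDNumber (Cycle 3) 4
redld-number-C₄ = redld-number-full (s≤s (s≤s z≤n)) λ {S} redld {u} _ →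
  decidable-stable (u ∈? S) λ u∉S →
    redld-twins-outside redld (next^-≢ u (s≤s z≤n) (s≤s (s≤s (s≤s z≤n))) ∘ sym) (twins u) u∉S (proj₂ (redld⇒sparse redld u u∉S))
  where
  open CycleProperties 3
  -- Here prev = next^ 3 unfolds to next ∘ next ∘ next.
  twins : ∀ u w → w ≢ u → w ≢ next (next u) → (Cycle 3 u w ⇔ Cycle 3 (next (next u)) w)
  twins u w _ _ = mk⇔ to from
    where
    to : Cycle 3 u w → Cycle 3 (next (next u)) w
    to Guw with Cycle⇒next Guw
    ... | inj₁ refl = Cycle-sym (Cycle-next (next u))
    ... | inj₂ u≡next-w = subst (Cycle 3 (next (next u))) (trans (cong prev u≡next-w) (prev-next w)) (Cycle-next (next (next u)))
    from : Cycle 3 (next (next u)) w → Cycle 3 u w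
    from Gw with Cycle⇒next Gw
    ... | inj₁ refl = Cycle-prev u
    ... | inj₂ next²≡next = subst (Cycle 3 u) (next-injective next²≡next) (Cycle-next u)

proposition1 : (m : ℕ) → 3 ≤ suc m →
    (5 ≤ suc m → REDLDNumber (Cycle m) (ceil2n/3 (suc m))) ×
    (suc m ≤ 4 → REDLDNumber (Cycle m) (suc m))
proposition1 0 (s≤s ())
proposition1 1 (s≤s (s≤s ()))
proposition1 2 _ = (λ { (s≤s (s≤s (s≤s ()))) }) , λ _ → redld-number-C₃
proposition1 3 _ = (λ { (s≤s (s≤s (s≤s (s≤s ())))) }) , λ _ → redld-number-C₄
proposition1 m@(suc (suc (suc (suc _)))) _ =
  CycleProperties.redld-number-large m , λ { (s≤s (s≤s (s≤s (s≤s ())))) }
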